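{- Let $G$ be a graph with connected components $G_1,\ldots,G_s$, where $s\ge 2$, and let $\mathcal{G}=\{G_i:\ \chi(G_i)=\chi(G),\ i\in[s]\}$. Then ${\rm es}_{\chi}(G)+{\rm es}_{\chi}(\overline{G})=2$ if and only if (i) $|\mathcal{G}|=1$ and ${\rm es}_{\chi}(G_i)=1$ for the component $G_i\in\mathcal{G}$, and (ii) there exists a component $G_j$ such that ${\rm es}_{\chi}(\overline{G_j})=1$, or there exist components $G_j$ and $G_k$ with $j\neq k$ such that $c^*(\overline{G_j})=1$ and $c^*(\overline{G_k})=1$.
   Context: All graphs are finite and simple; $\overline{H}$ denotes the complement of $H$ and $\chi(H)$ its chromatic number. The $\chi$-stability index ${\rm es}_{\chi}(H)$ of a graph $H$ with at least one edge is the minimum number of edges of $H$ whose removal results in a spanning subgraph with chromatic number smaller than $\chi(H)$; if $H$ has no edges, ${\rm es}_{\chi}(H)=0$. A $\chi$-coloring of $H$ is a proper vertex coloring using $\chi(H)$ colors, and $c^*(H)$ denotes the minimum cardinality of a color class over all $\chi$-colorings of $H$. -}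

module Defs where

open import Data.Nat using (ℕ; zero; suc; _+_; _<_; _≤_; _<ᵇ_)
open import Data.Fin using (Fin; toℕ; _≟_)
import Data.Fin as Fin
open import Data.Bool using (Bool; true; false; not; _∧_; _∨_; if_then_else_)
open import Data.Product using (Σ; ∃; _×_; _,_)
open import Data.Sum using (_⊎_)
open import Relation.Nullary using (¬_; does)
open import Relation.Binary.PropositionalEquality using (_≡_; _≢_)

Adj : ℕ → Set
Adj n = Fin n → Fin n → Bool

record SimpleGraph (n : ℕ) : Set where
  field
    adj    : Adj n
    sym    : ∀ i j → adj i j ≡ adj j i
    irrefl : ∀ i → adj i i ≡ false
open SimpleGraph public

-- Vertex subsets (decidable), used for induced subgraphs G[P].
VSet : ℕ → Set
VSet n = Fin n → Bool

allV : ∀ {n} → VSet n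
allV _ = true

-- Complement (on the same vertex set).  The complement of an induced
-- subgraph G[P] is (complement G)[P].
compl : ∀ {n} → Adj n → Adj n
compl A i j = not (A i j) ∧ not (does (i ≟ j))

sumV : ∀ {n} → (Fin n → ℕ) → ℕ
sumV {zero}  f = 0
sumV {suc n} f = f Fin.zero + sumV (λ i → f (Fin.suc i))

countV : ∀ {n} → (Fin n → Bool) → ℕ
countV p = sumV (λ i → if p i then 1 else 0)

Proper : ∀ {n} → Adj n → VSet n → (k : ℕ) → (Fin n → Fin k) → Set
Proper A P k c = ∀ i j → P i ≡ true → P j ≡ true → A i j ≡ true → c i ≢ c j

Colorable : ∀ {n} → Adj n → VSet n → ℕ → Set
Colorable A P k = Σ (_ → Fin k) λ c → Proper A P k c

IsChi : ∀ {n} → Adj n → VSet n → ℕ → Set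
IsChi A P k = Colorable A P k × (∀ k′ → k′ < k → ¬ Colorable A P k′)

HasEdge : ∀ {n} → Adj n → VSet n → Set
HasEdge A P = ∃ λ i → ∃ λ j → P i ≡ true × P j ≡ true × A i j ≡ true

-- An edge set F of A[P] is encoded by an arbitrary Boolean relation F:
-- the removed edges are the edges {i,j} of A[P] with F i j ∨ F j i.
removeE : ∀ {n} → Adj n → Adj n → Adj n
removeE A F i j = A i j ∧ not (F i j ∨ F j i)

-- number of edges of A[P] selected by F (unordered pairs, counted with i < j)
edgeCount : ∀ {n} → Adj n → VSet n → Adj n → ℕ
edgeCount A P F =
  sumV (λ i → countV (λ j → (toℕ i <ᵇ toℕ j) ∧ P i ∧ P j ∧ A i j ∧ (F i j ∨ F j i)))

Lowers : ∀ {n} → Adj n → VSet n → Adj n → Set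
Lowers A P F = ∃ λ k → Colorable (removeE A F) P k × ¬ Colorable A P k

IsEs : ∀ {n} → Adj n → VSet n → ℕ → Set
IsEs A P e =
    (¬ HasEdge A P × e ≡ 0)
  ⊎ (HasEdge A P
     × (∃ λ F → edgeCount A P F ≡ e × Lowers A P F)
     × (∀ F → Lowers A P F → e ≤ edgeCount A P F))

classSize : ∀ {n k} → VSet n → (Fin n → Fin k) → Fin k → ℕ
classSize P c a = countV (λ i → P i ∧ does (c i ≟ a))

IsCStar : ∀ {n} → Adj n → VSet n → ℕ → Set
IsCStar A P m = Σ ℕ λ k → IsChi A P k
  × (∃ λ c → Proper A P k c × ∃ λ a → classSize P c a ≡ m)
  × (∀ c → Proper A P k c → ∀ a → m ≤ classSize P c a)

data Reach {n} (A : Adj n) : Fin n → Fin n → Set where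
  here : ∀ {i} → Reach A i i
  step : ∀ {i j k} → A i j ≡ true → Reach A j k → Reach A i k

IsComponent : ∀ {n} → Adj n → VSet n → Set
IsComponent A P =
    (∃ λ v → P v ≡ true)
  × (∀ i j → P i ≡ true → A i j ≡ true → P j ≡ true)
  × (∀ i j → P i ≡ true → P j ≡ true → Reach A i j)

SameV : ∀ {n} → VSet n → VSet n → Set
SameV P Q = ∀ v → P v ≡ Q v

SameChi : ∀ {n} → Adj n → VSet n → VSet n → Set
SameChi A P Q = ∃ λ k → IsChi A P k × IsChi A Q k

module Submission where

-- Removing no edge never lowers χ, so es(H) ≥ 1 whenever H has an edge; Ḡ has an edge as G is
-- disconnected, hence a + b = 2 forces a = b = 1 (an edgeless G has a = 0 but b = 1, all its
-- components being single vertices).  The two equivalences are then proved separately: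
--  * es(G) = 1 ⇔ (i).  χ(G) is the maximum of χ over the components.  A critical edge uv of G
--    lies in every component C with χ(C) = χ(G), so there is only one; conversely a critical
--    edge of that unique component, with colourings of the others, lowers χ(G).
--  * es(Ḡ) = 1 ⇔ (ii).  Ḡ is the join of the complements of the components, so no colour class
--    meets two components and χ(Ḡ) is additive.  A critical edge uv of Ḡ is either critical in
--    one C̄, or joins components C, D in which u and v are singleton colour classes of
--    χ-colourings of C̄ and D̄ (they may then share a colour in Ḡ − uv).

open import Defs hiding (sym)
open import Data.Nat using (ℕ; zero; suc; _+_; _<_; _≤_; _<ᵇ_; _≡ᵇ_; z≤n; s≤s; _<?_)
import Data.Nat as ℕ
open import Data.Nat.Properties hiding (_≟_)
open import Data.Fin using (Fin; toℕ; _≟_; fromℕ<)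
import Data.Fin as Fin
import Data.Fin.Properties as FinP
open import Data.Bool using (Bool; true; false; not; _∧_; _∨_; if_then_else_; T)
import Data.Bool as Bool
open import Data.Bool.Properties using (∨-comm; ∨-zeroʳ; ∧-zeroʳ)
open import Data.Maybe using (Maybe; just; nothing; fromMaybe)
import Data.Maybe as Maybe
open import Data.Product using (Σ; ∃; _×_; _,_; proj₁; proj₂)
open import Data.Sum using (_⊎_; inj₁; inj₂; [_,_]′)
open import Data.Empty using (⊥; ⊥-elim)
open import Data.Unit using (tt)
open import Relation.Nullary using (¬_; does; yes; no)
open import Relation.Binary.Definitions using (tri<; tri≈; tri>)
open import Relation.Binary.PropositionalEquality
open import Function.Bundles using (_⇔_; mk⇔)

false≢true : false ≢ true
false≢true ()

bool-ext : ∀ {a b : Bool} → (a ≡ true → b ≡ true) → (b ≡ true → a ≡ true) → a ≡ b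
bool-ext {false} {false} f g = refl
bool-ext {false} {true}  f g = g refl
bool-ext {true}  {false} f g = sym (f refl)
bool-ext {true}  {true}  f g = refl

not-true : ∀ b → ¬ (b ≡ true) → b ≡ false
not-true false _ = refl
not-true true  h = ⊥-elim (h refl)

not-false : ∀ b → ¬ (b ≡ false) → b ≡ true
not-false true  _ = refl
not-false false h = ⊥-elim (h refl)

not-both : ∀ {b} → not b ≡ true → b ≡ true → ⊥
not-both {true} () _

∨-introˡ : ∀ {a} b → a ≡ true → (a ∨ b) ≡ true
∨-introˡ b refl = refl

∨-introʳ : ∀ a {b} → b ≡ true → (a ∨ b) ≡ true
∨-introʳ a refl = ∨-zeroʳ a

∨-elim : ∀ a {b} → (a ∨ b) ≡ true → a ≡ true ⊎ b ≡ true
∨-elim true  _ = inj₁ refl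
∨-elim false e = inj₂ e

∨-right : ∀ {a b} → (a ∨ b) ≡ true → a ≡ false → b ≡ true
∨-right {false} e _ = e

∧-intro : ∀ {a b} → a ≡ true → b ≡ true → (a ∧ b) ≡ true
∧-intro refl refl = refl

∧-elimˡ : ∀ a {b} → (a ∧ b) ≡ true → a ≡ true
∧-elimˡ true _ = refl

∧-elimʳ : ∀ a {b} → (a ∧ b) ≡ true → b ≡ true
∧-elimʳ true e = e

T→≡ : ∀ {b} → T b → b ≡ true
T→≡ {true} _ = refl

≡→T : ∀ {b} → b ≡ true → T b
≡→T refl = tt

n<ᵇn : ∀ m → (m <ᵇ m) ≡ false
n<ᵇn zero    = refl
n<ᵇn (suc m) = n<ᵇn m

does-refl : ∀ {n} (i : Fin n) → does (i ≟ i) ≡ true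
does-refl i with i ≟ i
... | yes _ = refl
... | no ne = ⊥-elim (ne refl)

does-sound : ∀ {n} (i j : Fin n) → does (i ≟ j) ≡ true → i ≡ j
does-sound i j e with i ≟ j
... | yes p = p

does-sym : ∀ {n} (i j : Fin n) → does (i ≟ j) ≡ does (j ≟ i)
does-sym i j = bool-ext (λ e → to (sym (does-sound i j e))) (λ e → to (sym (does-sound j i e)))
  where
  to : ∀ {a b : Fin _} → a ≡ b → does (a ≟ b) ≡ true
  to {a} refl = does-refl a

does-distinct : ∀ {n} (i j : Fin n) → i ≢ j → does (i ≟ j) ≡ false
does-distinct i j ne = not-true _ λ e → ne (does-sound i j e)

indicator : Bool → ℕ
indicator b = if b then 1 else 0

sumV-zero : ∀ {n} (f : Fin n → ℕ) → (∀ i → f i ≡ 0) → sumV f ≡ 0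
sumV-zero {zero}  f h = refl
sumV-zero {suc n} f h rewrite h Fin.zero = sumV-zero (λ i → f (Fin.suc i)) (λ i → h (Fin.suc i))

sumV-zero⁻ : ∀ {n} (f : Fin n → ℕ) → sumV f ≡ 0 → ∀ i → f i ≡ 0
sumV-zero⁻ {suc n} f h Fin.zero    = m+n≡0⇒m≡0 (f Fin.zero) h
sumV-zero⁻ {suc n} f h (Fin.suc i) = sumV-zero⁻ (λ i → f (Fin.suc i)) (m+n≡0⇒n≡0 (f Fin.zero) h) i

sumV-one : ∀ {n} (f : Fin n → ℕ) → sumV f ≡ 1 → ∃ λ i → f i ≡ 1 × (∀ j → f j ≢ 0 → j ≡ i)
sumV-one {suc n} f h with f Fin.zero in e
... | zero with sumV-one (λ i → f (Fin.suc i)) h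
...   | i , fi , u = Fin.suc i , fi , λ { Fin.zero nz → ⊥-elim (nz e) ; (Fin.suc j) nz → cong Fin.suc (u j nz) }
sumV-one {suc n} f h | suc zero = Fin.zero , e , λ
  { Fin.zero _ → refl
  ; (Fin.suc j) nz → ⊥-elim (nz (sumV-zero⁻ (λ i → f (Fin.suc i)) (suc-injective h) j)) }

sumV-mono : ∀ {n} (f g : Fin n → ℕ) → (∀ i → f i ≤ g i) → sumV f ≤ sumV g
sumV-mono {zero}  f g h = z≤n
sumV-mono {suc n} f g h =
  +-mono-≤ (h Fin.zero) (sumV-mono (λ i → f (Fin.suc i)) (λ i → g (Fin.suc i)) (λ i → h (Fin.suc i)))

sumV-≤1 : ∀ {n} (f : Fin n → ℕ) → (∀ i → f i ≤ 1) → (∀ i j → f i ≢ 0 → f j ≢ 0 → i ≡ j) → sumV f ≤ 1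
sumV-≤1 {zero} f b u = z≤n
sumV-≤1 {suc n} f b u with f Fin.zero in e
... | zero = sumV-≤1 (λ i → f (Fin.suc i)) (λ i → b (Fin.suc i))
               (λ i j p q → FinP.suc-injective (u (Fin.suc i) (Fin.suc j) p q))
... | suc k = subst (λ x → suc k + x ≤ 1) (sym (sumV-zero _ rest-zero))
                (subst (_≤ 1) (sym (+-identityʳ (suc k))) (subst (_≤ 1) e (b Fin.zero)))
  where
  rest-zero : ∀ i → f (Fin.suc i) ≡ 0
  rest-zero i with f (Fin.suc i) in e′
  ... | zero = refl
  ... | suc _ with u Fin.zero (Fin.suc i) (λ z → 1+n≢0 (trans (sym e) z)) (λ z → 1+n≢0 (trans (sym e′) z))
  ...   | ()

indicator-mono : ∀ {a b} → (a ≡ true → b ≡ true) → indicator a ≤ indicator b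
indicator-mono {false} _ = z≤n
indicator-mono {true}  h rewrite h refl = ≤-refl

countV-mono : ∀ {n} (p q : Fin n → Bool) → (∀ i → p i ≡ true → q i ≡ true) → countV p ≤ countV q
countV-mono p q h = sumV-mono _ _ λ i → indicator-mono (h i)

countV-strict : ∀ {n} (p q : Fin n → Bool) → (∀ i → p i ≡ true → q i ≡ true)
  → ∀ w → p w ≡ false → q w ≡ true → countV p < countV q
countV-strict {suc n} p q h Fin.zero pw qw rewrite pw | qw =
  s≤s (countV-mono (λ i → p (Fin.suc i)) (λ i → q (Fin.suc i)) (λ i → h (Fin.suc i)))
countV-strict {suc n} p q h (Fin.suc w) pw qw =
  +-mono-≤-< (indicator-mono (h Fin.zero))
    (countV-strict (λ i → p (Fin.suc i)) (λ i → q (Fin.suc i)) (λ i → h (Fin.suc i)) w pw qw)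

countV-all : ∀ n → countV {n} (λ _ → true) ≡ n
countV-all zero    = refl
countV-all (suc n) = cong suc (countV-all n)

countV-≤ : ∀ {n} (p : Fin n → Bool) → countV p ≤ n
countV-≤ {n} p = subst (countV p ≤_) (countV-all n) (countV-mono p (λ _ → true) (λ _ _ → refl))

countV-none : ∀ {n} (p : Fin n → Bool) → (∀ i → p i ≡ false) → countV p ≡ 0
countV-none p h = sumV-zero _ λ i → cong indicator (h i)

countV-pos : ∀ {n} (p : Fin n → Bool) → ∀ w → p w ≡ true → 1 ≤ countV p
countV-pos p w pw = ≤-trans (s≤s z≤n) (countV-strict (λ _ → false) p (λ _ ()) w refl pw)

countV-zero⁻ : ∀ {n} (p : Fin n → Bool) → countV p ≡ 0 → ∀ i → p i ≡ false
countV-zero⁻ p h i = not-true (p i) λ pi → 1+n≰n (subst (1 ≤_) h (countV-pos p i pi))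

countV-witness : ∀ {n} (p : Fin n → Bool) → countV p ≢ 0 → ∃ λ j → p j ≡ true
countV-witness {n} p nz with FinP.all? (λ j → p j Bool.≟ false)
... | yes none = ⊥-elim (nz (countV-none p none))
... | no some with FinP.¬∀⟶∃¬ n _ (λ j → p j Bool.≟ false) some
...   | j , nj = j , not-false (p j) nj

countV-≤1 : ∀ {n} (p : Fin n → Bool) → (∀ i j → p i ≡ true → p j ≡ true → i ≡ j) → countV p ≤ 1
countV-≤1 p h = sumV-≤1 _ (λ i → bounded (p i)) λ i j x y → h i j (nonzero (p i) x) (nonzero (p j) y)
  where
  bounded : ∀ b → indicator b ≤ 1
  bounded false = z≤n
  bounded true  = ≤-refl
  nonzero : ∀ b → indicator b ≢ 0 → b ≡ true
  nonzero b x = not-false b λ { refl → x refl }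

countV-single : ∀ {n} (p : Fin n → Bool) (u : Fin n) → p u ≡ true → (∀ i → p i ≡ true → i ≡ u) → countV p ≡ 1
countV-single p u pu h =
  ≤-antisym (countV-≤1 p λ i j x y → trans (h i x) (sym (h j y))) (countV-pos p u pu)

countV-one : ∀ {n} (p : Fin n → Bool) → countV p ≡ 1 → ∃ λ j → p j ≡ true × (∀ j′ → p j′ ≡ true → j′ ≡ j)
countV-one p e with sumV-one _ e
... | j , fj , u = j , one (p j) fj , λ j′ pj′ → u j′ (nonzero pj′)
  where
  one : ∀ b → indicator b ≡ 1 → b ≡ true
  one true _ = refl
  nonzero : ∀ {b} → b ≡ true → indicator b ≢ 0
  nonzero refl ()

countV-∨∧ : ∀ {n} (p q : Fin n → Bool) →
  countV p + countV q ≡ countV (λ i → p i ∨ q i) + countV (λ i → p i ∧ q i)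
countV-∨∧ {zero} p q = refl
countV-∨∧ {suc n} p q with p Fin.zero | q Fin.zero | countV-∨∧ (λ i → p (Fin.suc i)) (λ i → q (Fin.suc i))
... | false | false | ih = ih
... | false | true  | ih = trans (+-suc _ _) (cong suc ih)
... | true  | false | ih = cong suc ih
... | true  | true  | ih = cong suc (trans (+-suc _ _) (trans (cong suc ih) (sym (+-suc _ _))))

anyV : ∀ {n} → (Fin n → Bool) → Bool
anyV {zero}  p = false
anyV {suc n} p = p Fin.zero ∨ anyV (λ i → p (Fin.suc i))

anyV-intro : ∀ {n} (p : Fin n → Bool) i → p i ≡ true → anyV p ≡ true
anyV-intro p Fin.zero e = ∨-introˡ _ e
anyV-intro p (Fin.suc i) e = ∨-introʳ (p Fin.zero) (anyV-intro (λ i → p (Fin.suc i)) i e)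

anyV-elim : ∀ {n} (p : Fin n → Bool) → anyV p ≡ true → ∃ λ i → p i ≡ true
anyV-elim {suc n} p e with ∨-elim (p Fin.zero) e
... | inj₁ e0 = Fin.zero , e0
... | inj₂ e1 with anyV-elim (λ i → p (Fin.suc i)) e1
...   | i , q = Fin.suc i , q

anyV-resp : ∀ {n} (p q : Fin n → Bool) → (∀ i → p i ≡ q i) → anyV p ≡ anyV q
anyV-resp {zero}  p q h = refl
anyV-resp {suc n} p q h = cong₂ _∨_ (h Fin.zero) (anyV-resp _ _ λ i → h (Fin.suc i))

-- The first index where a predicate holds; it depends only on the predicate's values,
-- which makes it a canonical choice of representative.
firstTrue : ∀ {n} → (Fin n → Bool) → Maybe (Fin n)
firstTrue {zero}  p = nothing
firstTrue {suc n} p = if p Fin.zero then just Fin.zero else Maybe.map Fin.suc (firstTrue (λ i → p (Fin.suc i)))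

firstTrue-resp : ∀ {n} (p q : Fin n → Bool) → (∀ i → p i ≡ q i) → firstTrue p ≡ firstTrue q
firstTrue-resp {zero}  p q h = refl
firstTrue-resp {suc n} p q h
  rewrite h Fin.zero | firstTrue-resp (λ i → p (Fin.suc i)) (λ i → q (Fin.suc i)) (λ i → h (Fin.suc i)) = refl

firstTrue-sound : ∀ {n} (p : Fin n → Bool) r → firstTrue p ≡ just r → p r ≡ true
firstTrue-sound {suc n} p r e with p Fin.zero in e0
firstTrue-sound {suc n} p r refl | true = e0
... | false with firstTrue (λ i → p (Fin.suc i)) in e1
firstTrue-sound {suc n} p r refl | false | just r′ = firstTrue-sound (λ i → p (Fin.suc i)) r′ e1

firstTrue-complete : ∀ {n} (p : Fin n → Bool) i → p i ≡ true → ∃ λ r → firstTrue p ≡ just r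
firstTrue-complete {suc n} p Fin.zero e rewrite e = Fin.zero , refl
firstTrue-complete {suc n} p (Fin.suc i) e with p Fin.zero
... | true = Fin.zero , refl
... | false with firstTrue-complete (λ i → p (Fin.suc i)) i e
...   | r , q rewrite q = Fin.suc r , refl

-- Unlike Fin-valued colourings these can be shifted and combined freely; toCol / fromCol
-- translate to the Colorable of the definitions.

ProperN : ∀ {n} → Adj n → VSet n → (Fin n → ℕ) → Set
ProperN A P c = ∀ i j → P i ≡ true → P j ≡ true → A i j ≡ true → c i ≢ c j

Col : ∀ {n} → Adj n → VSet n → ℕ → Set
Col {n} A P k = Σ (Fin n → ℕ) λ c → (∀ i → P i ≡ true → c i < k) × ProperN A P c

col-restrict : ∀ {n} {A B : Adj n} {P Q : VSet n} {k} → (∀ i → P i ≡ true → Q i ≡ true)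
  → (∀ i j → P i ≡ true → P j ≡ true → A i j ≡ true → B i j ≡ true) → Col B Q k → Col A P k
col-restrict P⊆Q A⊆B (c , bd , pr) =
  c , (λ i pi → bd i (P⊆Q i pi)) , λ i j pi pj e → pr i j (P⊆Q i pi) (P⊆Q j pj) (A⊆B i j pi pj e)

col-weaken : ∀ {n} {A : Adj n} {P k k′} → Col A P k → k ≤ k′ → Col A P k′
col-weaken (c , bd , pr) le = c , (λ i pi → ≤-trans (bd i pi) le) , pr

toCol : ∀ {n} {A : Adj n} {P k} → Colorable A P k → Col A P k
toCol (c , pr) = (λ i → toℕ (c i)) , (λ i _ → FinP.toℕ<n (c i)) ,
  λ i j pi pj e eq → pr i j pi pj e (FinP.toℕ-injective eq)

toFin : ∀ k → ℕ → Fin (suc k)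
toFin k x with x <? suc k
... | yes p = fromℕ< p
... | no _  = Fin.zero

toℕ-toFin : ∀ k x → x < suc k → toℕ (toFin k x) ≡ x
toℕ-toFin k x lt with x <? suc k
... | yes p = FinP.toℕ-fromℕ< p
... | no np = ⊥-elim (np lt)

toFin-injective : ∀ k {x y} → x < suc k → y < suc k → toFin k x ≡ toFin k y → x ≡ y
toFin-injective k {x} {y} x< y< eq = trans (sym (toℕ-toFin k x x<)) (trans (cong toℕ eq) (toℕ-toFin k y y<))

-- (the vertex v only serves to exclude k = 0 for a non-empty P)
fromCol : ∀ {n} {A : Adj n} {P k} v → P v ≡ true → Col A P k → Colorable A P k
fromCol {k = zero}  v pv (c , bd , pr) = ⊥-elim (n≮0 (bd v pv))
fromCol {k = suc k} v pv (c , bd , pr) = (λ i → toFin k (c i)) ,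
  λ i j pi pj e eq → pr i j pi pj e (toFin-injective k (bd i pi) (bd j pj) eq)

col-join : ∀ {n} {A : Adj n} {P Q R : VSet n} {t₁ t₂} → Col A P t₁ → Col A Q t₂
  → (∀ i → R i ≡ true → P i ≡ false → Q i ≡ true) → Col A R (t₁ + t₂)
col-join {n} {A} {P} {Q} {R} {t₁} {t₂} (c₁ , b₁ , p₁) (c₂ , b₂ , p₂) R⊆P∪Q = c , bd , pr
  where
  c : Fin n → ℕ
  c i = if P i then c₁ i else t₁ + c₂ i
  bd : ∀ i → R i ≡ true → c i < t₁ + t₂
  bd i ri with P i in e
  ... | true  = ≤-trans (b₁ i e) (m≤m+n t₁ t₂)
  ... | false = +-monoʳ-< t₁ (b₂ i (R⊆P∪Q i ri e))
  pr : ProperN A R c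
  pr i j ri rj a with P i in ei | P j in ej
  ... | true  | true  = p₁ i j ei ej a
  ... | false | false = λ eq → p₂ i j (R⊆P∪Q i ri ei) (R⊆P∪Q j rj ej) a (+-cancelˡ-≡ t₁ _ _ eq)
  ... | true  | false = λ eq → <-irrefl eq (≤-trans (b₁ i ei) (m≤m+n t₁ _))
  ... | false | true  = λ eq → <-irrefl (sym eq) (≤-trans (b₁ j ej) (m≤m+n t₁ _))

col-fresh : ∀ {n} {A B : Adj n} {P : VSet n} {k} (u : Fin n) → (∀ i → A i i ≡ false)
  → (∀ i j → P i ≡ true → P j ≡ true → A i j ≡ true → i ≢ u → j ≢ u → B i j ≡ true)
  → Col B P k → Col A P (suc k)
col-fresh {n} {A} {B} {P} {k} u irrefl away (c , b , p) = c′ , bd , pr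
  where
  c′ : Fin n → ℕ
  c′ w = if does (w ≟ u) then k else c w
  bd : ∀ i → P i ≡ true → c′ i < suc k
  bd i pi with i ≟ u
  ... | yes _ = ≤-refl
  ... | no _  = ≤-trans (b i pi) (n≤1+n k)
  pr : ProperN A P c′
  pr i j pi pj a with i ≟ u | j ≟ u
  ... | yes refl | yes refl = ⊥-elim (false≢true (trans (sym (irrefl i)) a))
  ... | yes _    | no _     = λ eq → <-irrefl (sym eq) (b j pj)
  ... | no _     | yes _    = λ eq → <-irrefl eq (b i pi)
  ... | no ni    | no nj    = p i j pi pj (away i j pi pj a ni nj)

col-trivial : ∀ {n} (A : Adj n) P → (∀ i → A i i ≡ false) → Col A P n
col-trivial A P irrefl = toℕ , (λ i _ → FinP.toℕ<n i) ,
  λ i j _ _ a eq → false≢true (trans (sym (irrefl i)) (subst (λ x → A i x ≡ true) (sym (FinP.toℕ-injective eq)) a))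

-- Compressing a colouring of A[P] to the colours it actually uses: colour x is
-- renamed to the number of used colours below x.
module Compress {n : ℕ} (A : Adj n) (P : VSet n) (c : Fin n → ℕ) (t : ℕ)
                (bd : ∀ i → P i ≡ true → c i < t) where

  used : Fin t → Bool
  used y = anyV (λ i → P i ∧ (c i ≡ᵇ toℕ y))

  rank : ℕ → ℕ
  rank x = countV (λ y → used y ∧ (toℕ y <ᵇ x))

  colourOf : ∀ i → P i ≡ true → Fin t
  colourOf i pi = fromℕ< (bd i pi)

  used-colourOf : ∀ i (pi : P i ≡ true) → used (colourOf i pi) ≡ true
  used-colourOf i pi =
    anyV-intro _ i (∧-intro pi (T→≡ (≡⇒≡ᵇ (c i) _ (sym (FinP.toℕ-fromℕ< (bd i pi))))))

  used-elim : ∀ y → used y ≡ true → ∃ λ i → P i ≡ true × c i ≡ toℕ y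
  used-elim y e with anyV-elim _ e
  ... | i , q = i , ∧-elimˡ _ q , ≡ᵇ⇒≡ (c i) _ (≡→T (∧-elimʳ (P i) q))

  not-below-self : ∀ i (pi : P i ≡ true) → (used (colourOf i pi) ∧ (toℕ (colourOf i pi) <ᵇ c i)) ≡ false
  not-below-self i pi = trans (cong (used (colourOf i pi) ∧_)
    (trans (cong (_<ᵇ c i) (FinP.toℕ-fromℕ< (bd i pi))) (n<ᵇn (c i)))) (∧-zeroʳ _)

  rank-lt : ∀ i → P i ≡ true → rank (c i) < countV used
  rank-lt i pi =
    countV-strict _ used (λ y q → ∧-elimˡ _ q) (colourOf i pi) (not-below-self i pi) (used-colourOf i pi)

  rank-mono : ∀ i j → P i ≡ true → P j ≡ true → c i < c j → rank (c i) < rank (c j)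
  rank-mono i j pi pj lt = countV-strict _ _
    (λ y q → ∧-intro (∧-elimˡ _ q) (T→≡ (<⇒<ᵇ (<-trans (<ᵇ⇒< _ _ (≡→T (∧-elimʳ (used y) q))) lt))))
    (colourOf i pi) (not-below-self i pi)
    (∧-intro (used-colourOf i pi) (T→≡ (<⇒<ᵇ (subst (_< c j) (sym (FinP.toℕ-fromℕ< (bd i pi))) lt))))

  rank-injective : ∀ i j → P i ≡ true → P j ≡ true → rank (c i) ≡ rank (c j) → c i ≡ c j
  rank-injective i j pi pj eq with <-cmp (c i) (c j)
  ... | tri< lt _ _ = ⊥-elim (<-irrefl eq (rank-mono i j pi pj lt))
  ... | tri≈ _ e _  = e
  ... | tri> _ _ gt = ⊥-elim (<-irrefl (sym eq) (rank-mono j i pj pi gt))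

  compressed : ProperN A P c → Col A P (countV used)
  compressed pr = (λ i → rank (c i)) , rank-lt , λ i j pi pj a eq → pr i j pi pj a (rank-injective i j pi pj eq)

drop-unused-colour : ∀ {n} (X : Adj n) (Y : VSet n) k (c : Fin n → Fin (suc k)) → Proper X Y (suc k) c
  → (a : Fin (suc k)) → (∀ i → Y i ≡ true → c i ≢ a) → Col X Y k
drop-unused-colour X Y k c prc a avoid = col-weaken (C.compressed prN) few
  where
  module C = Compress X Y (λ i → toℕ (c i)) (suc k) (λ i _ → FinP.toℕ<n (c i))
  prN : ProperN X Y (λ i → toℕ (c i))
  prN i j yi yj x eq = prc i j yi yj x (FinP.toℕ-injective eq)
  a-unused : C.used a ≡ false
  a-unused = not-true _ λ u → let (i , yi , eq) = C.used-elim a u in avoid i yi (FinP.toℕ-injective eq)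
  few : countV C.used ≤ k
  few = ≤-pred (≤-trans (countV-strict C.used (λ _ → true) (λ _ _ → refl) a a-unused refl)
                        (≤-reflexive (countV-all (suc k))))

col-glue-closed : ∀ {n} {A : Adj n} {P : VSet n} {k} → (∀ i j → A i j ≡ true → P i ≡ P j)
  → Col A P k → Col A (λ i → not (P i)) k → Col A allV k
col-glue-closed {n} {A} {P} {k} no-cross (c₁ , b₁ , p₁) (c₂ , b₂ , p₂) = c , bd , pr
  where
  c : Fin n → ℕ
  c i = if P i then c₁ i else c₂ i
  bd : ∀ i → true ≡ true → c i < k
  bd i _ with P i in e
  ... | true  = b₁ i e
  ... | false = b₂ i (cong not e)
  pr : ProperN A allV c
  pr i j _ _ a with P i in ei | P j in ej | no-cross i j a
  ... | true  | true  | _ = p₁ i j ei ej a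
  ... | false | false | _ = p₂ i j (cong not ei) (cong not ej) a

-- Splitting a colouring c of A[R] with t colours between two sets P, Q ⊆ R: each part is
-- compressed to the colours it uses, and the two palettes overlap only in shared colours.
module Split {n : ℕ} (A : Adj n) (R P Q : VSet n) (c : Fin n → ℕ) (t : ℕ)
             (bd : ∀ i → R i ≡ true → c i < t) (pr : ProperN A R c)
             (P⊆R : ∀ i → P i ≡ true → R i ≡ true) (Q⊆R : ∀ i → Q i ≡ true → R i ≡ true) where

  module CP = Compress A P c t (λ i pi → bd i (P⊆R i pi))
  module CQ = Compress A Q c t (λ i qi → bd i (Q⊆R i qi))

  colP : Col A P (countV CP.used)
  colP = CP.compressed λ i j pi pj → pr i j (P⊆R i pi) (P⊆R j pj)

  colQ : Col A Q (countV CQ.used)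
  colQ = CQ.compressed λ i j qi qj → pr i j (Q⊆R i qi) (Q⊆R j qj)

  palettes : countV CP.used + countV CQ.used ≤ t + countV (λ y → CP.used y ∧ CQ.used y)
  palettes = ≤-trans (≤-reflexive (countV-∨∧ CP.used CQ.used))
    (+-monoˡ-≤ (countV (λ y → CP.used y ∧ CQ.used y)) (countV-≤ (λ y → CP.used y ∨ CQ.used y)))

  shared : ∀ y → (CP.used y ∧ CQ.used y) ≡ true
    → ∃ λ p → ∃ λ q → P p ≡ true × Q q ≡ true × c p ≡ toℕ y × c q ≡ toℕ y
  shared y e with CP.used-elim y (∧-elimˡ _ e) | CQ.used-elim y (∧-elimʳ (CP.used y) e)
  ... | p , pp , cp | q , qq , cq = p , q , pp , qq , cp , cq

  split-disjoint : (∀ p q → P p ≡ true → Q q ≡ true → c p ≢ c q) →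
    Σ ℕ λ t₁ → Σ ℕ λ t₂ → Col A P t₁ × Col A Q t₂ × t₁ + t₂ ≤ t
  split-disjoint apart = _ , _ , colP , colQ ,
    ≤-trans palettes (≤-reflexive (trans (cong (t +_) (countV-none _ none-shared)) (+-identityʳ t)))
    where
    none-shared : ∀ y → (CP.used y ∧ CQ.used y) ≡ false
    none-shared y = not-true _ λ e →
      let (p , q , pp , qq , cp , cq) = shared y e in apart p q pp qq (trans cp (sym cq))

  -- only the colour x₀ may be shared: the palettes add up to at most t + 1; the compressed
  -- colouring of P is returned, as it separates exactly what c separates on P
  split-one-shared : ∀ x₀ → (∀ p q → P p ≡ true → Q q ≡ true → c p ≡ c q → c p ≡ x₀) →
    Σ ℕ λ t₁ → Σ ℕ λ t₂ → Col A Q t₂ × t₁ + t₂ ≤ suc t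
    × (Σ (Fin n → ℕ) λ c′ → (∀ i → P i ≡ true → c′ i < t₁) × ProperN A P c′
        × (∀ i j → P i ≡ true → P j ≡ true → c′ i ≡ c′ j → c i ≡ c j))
  split-one-shared x₀ only = _ , _ , colQ ,
    ≤-trans palettes (≤-trans (+-monoʳ-≤ t (countV-≤1 _ at-most-one)) (≤-reflexive (+-comm t 1))) ,
    (λ i → CP.rank (c i)) , CP.rank-lt , proj₂ (proj₂ colP) , CP.rank-injective
    where
    shared-is-x₀ : ∀ y → (CP.used y ∧ CQ.used y) ≡ true → toℕ y ≡ x₀
    shared-is-x₀ y e = let (p , q , pp , qq , cp , cq) = shared y e in
      trans (sym cp) (only p q pp qq (trans cp (sym cq)))
    at-most-one : ∀ y y′ → (CP.used y ∧ CQ.used y) ≡ true → (CP.used y′ ∧ CQ.used y′) ≡ true → y ≡ y′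
    at-most-one y y′ e e′ = FinP.toℕ-injective (trans (shared-is-x₀ y e) (sym (shared-is-x₀ y′ e′)))

-- The component of v is computed
-- as the n-th stage of the breadth-first closure of {v}; the closure must be stable after
-- n rounds because each unstable round adds a vertex.

module Components {n : ℕ} (A : Adj n) (A-sym : ∀ i j → A i j ≡ A j i) where

  reach-snoc : ∀ {i j k} → Reach A i j → A j k ≡ true → Reach A i k
  reach-snoc here       e = step e here
  reach-snoc (step x r) e = step x (reach-snoc r e)

  reach-trans : ∀ {i j k} → Reach A i j → Reach A j k → Reach A i k
  reach-trans here       r′ = r′
  reach-trans (step x r) r′ = step x (reach-trans r r′)

  reach-sym : ∀ {i j} → Reach A i j → Reach A j i
  reach-sym here = here
  reach-sym (step {i} {j} x r) = reach-snoc (reach-sym r) (trans (A-sym j i) x)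

  Closed : VSet n → Set
  Closed P = ∀ i j → P i ≡ true → A i j ≡ true → P j ≡ true

  closed-reach : ∀ P → Closed P → ∀ {i j} → P i ≡ true → Reach A i j → P j ≡ true
  closed-reach P cl pi here       = pi
  closed-reach P cl pi (step x r) = closed-reach P cl (cl _ _ pi x) r

  singleton : Fin n → VSet n
  singleton v w = does (w ≟ v)

  grow : VSet n → VSet n
  grow S w = S w ∨ anyV (λ m → S m ∧ A m w)

  grow-incl : ∀ S w → S w ≡ true → grow S w ≡ true
  grow-incl S w e = ∨-introˡ _ e

  grow-resp : ∀ S S′ → (∀ w → S w ≡ S′ w) → ∀ w → grow S w ≡ grow S′ w
  grow-resp S S′ h w = cong₂ _∨_ (h w) (anyV-resp _ _ λ m → cong (_∧ A m w) (h m))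

  stage : Fin n → ℕ → VSet n
  stage v zero    = singleton v
  stage v (suc t) = grow (stage v t)

  comp : Fin n → VSet n
  comp v = stage v n

  stable-or-large : ∀ v t → (∀ w → grow (stage v t) w ≡ stage v t w) ⊎ (suc t ≤ countV (stage v t))
  stable-or-large v zero =
    inj₂ (≤-reflexive (sym (countV-single (singleton v) v (does-refl v) (λ w → does-sound w v))))
  stable-or-large v (suc t) with stable-or-large v t
  ... | inj₁ stable = inj₁ λ w → grow-resp (stage v (suc t)) (stage v t) stable w
  ... | inj₂ large with FinP.all? (λ w → stage v (suc t) w Bool.≟ stage v t w)
  ...   | yes same = inj₁ λ w → grow-resp (stage v (suc t)) (stage v t) same w
  ...   | no differ with FinP.¬∀⟶∃¬ n _ (λ w → stage v (suc t) w Bool.≟ stage v t w) differ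
  ...     | w , nw = inj₂ (≤-trans (s≤s large)
                (countV-strict (stage v t) (stage v (suc t)) (λ i e → grow-incl _ i e) w old new))
    where
    old : stage v t w ≡ false
    old = not-true _ (λ e → nw (trans (grow-incl _ w e) (sym e)))
    new : stage v (suc t) w ≡ true
    new = not-false _ (λ e → nw (trans e (sym old)))

  comp-stable : ∀ v w → grow (comp v) w ≡ comp v w
  comp-stable v with stable-or-large v n
  ... | inj₁ stable = stable
  ... | inj₂ large  = ⊥-elim (1+n≰n (≤-trans large (countV-≤ (comp v))))

  comp-closed : ∀ v → Closed (comp v)
  comp-closed v m w cm e = trans (sym (comp-stable v w))
    (∨-introʳ (comp v w) (anyV-intro (λ m′ → comp v m′ ∧ A m′ w) m (∧-intro cm e)))

  stage-self : ∀ v t → stage v t v ≡ true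
  stage-self v zero    = does-refl v
  stage-self v (suc t) = grow-incl _ v (stage-self v t)

  comp-self : ∀ v → comp v v ≡ true
  comp-self v = stage-self v n

  stage-reach : ∀ v t w → stage v t w ≡ true → Reach A v w
  stage-reach v zero w e rewrite does-sound w v e = here
  stage-reach v (suc t) w e with ∨-elim (stage v t w) e
  ... | inj₁ old = stage-reach v t w old
  ... | inj₂ new with anyV-elim _ new
  ...   | m , q = reach-snoc (stage-reach v t m (∧-elimˡ _ q)) (∧-elimʳ (stage v t m) q)

  comp-reach : ∀ v w → comp v w ≡ true → Reach A v w
  comp-reach v = stage-reach v n

  reach-comp : ∀ v w → Reach A v w → comp v w ≡ true
  reach-comp v w r = closed-reach (comp v) (comp-closed v) (comp-self v) r

  comp-isComponent : ∀ v → IsComponent A (comp v)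
  comp-isComponent v = (v , comp-self v) , comp-closed v ,
    λ i j ci cj → reach-trans (reach-sym (comp-reach v i ci)) (comp-reach v j cj)

  comp-unique : ∀ P → IsComponent A P → ∀ v → P v ≡ true → ∀ w → P w ≡ comp v w
  comp-unique P (_ , cl , conn) v pv w = bool-ext
    (λ pw → reach-comp v w (conn v w pv pw))
    (λ cw → closed-reach P cl pv (comp-reach v w cw))

  components-meet : ∀ P Q → IsComponent A P → IsComponent A Q → ∀ v → P v ≡ true → Q v ≡ true → SameV P Q
  components-meet P Q cP cQ v pv qv w = trans (comp-unique P cP v pv w) (sym (comp-unique Q cQ v qv w))

  components-disjoint : ∀ P Q → IsComponent A P → IsComponent A Q → ¬ SameV P Q → ∀ w → P w ≡ true → Q w ≡ false
  components-disjoint P Q cP cQ P≢Q w pw = not-true _ λ qw → P≢Q (components-meet P Q cP cQ w pw qw)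

  comp-of-member : ∀ v w → comp v w ≡ true → SameV (comp v) (comp w)
  comp-of-member v w e = comp-unique (comp v) (comp-isComponent v) w e

  rep : Fin n → Fin n
  rep w = fromMaybe w (firstTrue (comp w))

  rep-mem : ∀ w → comp w (rep w) ≡ true
  rep-mem w with firstTrue-complete (comp w) w (comp-self w)
  ... | r , q rewrite q = firstTrue-sound (comp w) r q

  rep-resp : ∀ i j → comp i j ≡ true → rep i ≡ rep j
  rep-resp i j e with firstTrue-complete (comp i) i (comp-self i)
  ... | r , q = trans (cong (fromMaybe i) q) (sym (cong (fromMaybe j) (trans (sym first-same) q)))
    where
    first-same : firstTrue (comp i) ≡ firstTrue (comp j)
    first-same = firstTrue-resp (comp i) (comp j) (comp-of-member i j e)

  comp-no-cross : ∀ v i j → A i j ≡ true → comp v i ≡ comp v j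
  comp-no-cross v i j a = bool-ext (λ ci → comp-closed v i j ci a) (λ cj → comp-closed v j i cj (trans (A-sym j i) a))

  -- Colourings of all components of a subgraph A′ of A combine into one colouring of A′;
  -- each vertex takes its colour from the colouring chosen for its representative.
  col-glue-components : ∀ {A′ : Adj n} {k} → (∀ i j → A′ i j ≡ true → A i j ≡ true)
    → (∀ v → Col A′ (comp v) k) → Col A′ allV k
  col-glue-components {A′} {k} A′⊆A cols = c , bd , pr
    where
    in-rep-comp : ∀ w x → comp w x ≡ true → comp (rep w) x ≡ true
    in-rep-comp w x e = trans (sym (comp-of-member w (rep w) (rep-mem w) x)) e
    c : Fin n → ℕ
    c w = proj₁ (cols (rep w)) w
    bd : ∀ i → true ≡ true → c i < k
    bd i _ = proj₁ (proj₂ (cols (rep i))) i (in-rep-comp i i (comp-self i))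
    pr : ProperN A′ allV c
    pr i j _ _ a rewrite rep-resp i j (comp-closed i i j (comp-self i) (A′⊆A i j a)) =
      proj₂ (proj₂ (cols (rep j))) i j
        (in-rep-comp j i (comp-closed j j i (comp-self j) (trans (A-sym j i) (A′⊆A i j a))))
        (in-rep-comp j j (comp-self j)) a

ChiN : ∀ {n} → Adj n → VSet n → ℕ → Set
ChiN A P k = Col A P k × (∀ k′ → k′ < k → ¬ Col A P k′)

chiN-unique : ∀ {n} {A : Adj n} {P k k′} → ChiN A P k → ChiN A P k′ → k ≡ k′
chiN-unique {k = k} {k′} (c , min) (c′ , min′) with <-cmp k k′
... | tri< lt _ _ = ⊥-elim (min′ k lt c)
... | tri≈ _ e _  = e
... | tri> _ _ gt = ⊥-elim (min k′ gt c′)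

isChi→chiN : ∀ {n} {A : Adj n} {P k} v → P v ≡ true → IsChi A P k → ChiN A P k
isChi→chiN v pv (c , min) = toCol c , λ k′ lt c′ → min k′ lt (fromCol v pv c′)

chiN→isChi : ∀ {n} {A : Adj n} {P k} v → P v ≡ true → ChiN A P k → IsChi A P k
chiN→isChi v pv (c , min) = fromCol v pv c , λ k′ lt c′ → min k′ lt (toCol c′)

chiN-suc : ∀ {n} {A : Adj n} {P k} → Col A P (suc k) → ¬ Col A P k → ChiN A P (suc k)
chiN-suc c nc = c , λ k′ lt c′ → nc (col-weaken c′ (≤-pred lt))

-- Existence statements that need classical reasoning are obtained under a double negation;
-- this suffices because the goals they serve are equations between natural numbers.

¬¬-excluded-middle : ∀ (E : Set) → ¬ ¬ (E ⊎ ¬ E)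
¬¬-excluded-middle E k = k (inj₂ (λ e → k (inj₁ e)))

¬¬-least-below : (Q : ℕ → Set) → ∀ bound m → m < bound → Q m → ¬ ¬ (Σ ℕ λ r → Q r × (∀ s → Q s → r ≤ s))
¬¬-least-below Q (suc bound) m lt qm k = ¬¬-excluded-middle (Σ ℕ λ s → s < m × Q s) λ
  { (inj₁ (s , s<m , qs)) → ¬¬-least-below Q bound s (≤-trans s<m (≤-pred lt)) qs k
  ; (inj₂ none-below) → k (m , qm , λ s qs → ≮⇒≥ (λ s<m → none-below (s , s<m , qs))) }

¬¬-chromatic : ∀ {n} (A : Adj n) P → (∀ i → A i i ≡ false) → ¬ ¬ (Σ ℕ λ r → Col A P r × (∀ s → Col A P s → r ≤ s))
¬¬-chromatic {n} A P irrefl = ¬¬-least-below (Col A P) (suc n) n ≤-refl (col-trivial A P irrefl)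

¬¬-∀Fin : ∀ {n} (X : Fin n → Set) → (∀ i → ¬ ¬ X i) → ¬ ¬ (∀ i → X i)
¬¬-∀Fin {zero}  X h k = k (λ ())
¬¬-∀Fin {suc n} X h k = h Fin.zero λ x₀ → ¬¬-∀Fin (λ i → X (Fin.suc i)) (λ i → h (Fin.suc i))
  λ xs → k λ { Fin.zero → x₀ ; (Fin.suc i) → xs i }

¬¬-≡ : ∀ {a b : ℕ} → ¬ ¬ (a ≡ b) → a ≡ b
¬¬-≡ {a} {b} h with a ℕ.≟ b
... | yes e = e
... | no ne = ⊥-elim (h ne)

needs-suc : ∀ {n} {A : Adj n} {P k} → ¬ Col A P k → ∀ t → Col A P t → suc k ≤ t
needs-suc nk t c = ≰⇒> λ t≤k → nk (col-weaken c t≤k)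

chiN-needs : ∀ {n} {A : Adj n} {P s} → ChiN A P s → ∀ t → Col A P t → s ≤ t
chiN-needs (_ , min) t c = ≮⇒≥ λ t<s → min t t<s c

-- In a complete join colour counts add up: if X has every edge between P, Q ⊆ R, and A[P],
-- A[Q] need at least s₁, s₂ colours, then every colouring of X[R] uses at least s₁ + s₂.
join-bound : ∀ {n} (X : Adj n) (R P Q : VSet n) {s₁ s₂ t}
  → (∀ i → P i ≡ true → R i ≡ true) → (∀ i → Q i ≡ true → R i ≡ true)
  → (∀ p q → P p ≡ true → Q q ≡ true → X p q ≡ true)
  → (∀ t₁ → Col X P t₁ → s₁ ≤ t₁) → (∀ t₂ → Col X Q t₂ → s₂ ≤ t₂) → Col X R t → s₁ + s₂ ≤ t
join-bound X R P Q P⊆R Q⊆R complete need₁ need₂ (c , bd , pr)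
  with Split.split-disjoint X R P Q c _ bd pr P⊆R Q⊆R
         (λ p q pp qq → pr p q (P⊆R p pp) (Q⊆R q qq) (complete p q pp qq))
... | t₁ , t₂ , c₁ , c₂ , le = ≤-trans (+-mono-≤ (need₁ t₁ c₁) (need₂ t₂ c₂)) le

chi-classes-nonempty : ∀ {n} {X : Adj n} {Y : VSet n} {t} → ChiN X Y (suc t)
  → ∀ c → Proper X Y (suc t) c → ∀ a → 1 ≤ classSize Y c a
chi-classes-nonempty {X = X} {Y} {t} chi c pr a with classSize Y c a in empty
... | suc _ = s≤s z≤n
... | zero  = ⊥-elim (proj₂ chi t ≤-refl (drop-unused-colour X Y t c pr a avoid))
  where
  avoid : ∀ i → Y i ≡ true → c i ≢ a
  avoid i yi refl = false≢true (trans (sym (countV-zero⁻ _ empty i)) (∧-intro yi (does-refl (c i))))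

cstar-one : ∀ {n} (X : Adj n) (Y : VSet n) t y → Y y ≡ true → ChiN X Y t
  → (c : Fin n → ℕ) → (∀ i → Y i ≡ true → c i < t) → ProperN X Y c
  → (∀ i → Y i ≡ true → c i ≡ c y → i ≡ y) → IsCStar X Y 1
cstar-one X Y zero y yy chi c bd pr alone = ⊥-elim (n≮0 (bd y yy))
cstar-one {n} X Y (suc t) y yy chi c bd pr alone =
  suc t , chiN→isChi y yy chi , (d , pr-d , d y , class-y) , λ c′ pr′ a → chi-classes-nonempty chi c′ pr′ a
  where
  d : Fin n → Fin (suc t)
  d i = toFin t (c i)
  d-injective : ∀ i j → Y i ≡ true → Y j ≡ true → d i ≡ d j → c i ≡ c j
  d-injective i j yi yj = toFin-injective t (bd i yi) (bd j yj)
  pr-d : Proper X Y (suc t) d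
  pr-d i j yi yj x eq = pr i j yi yj x (d-injective i j yi yj eq)
  class-y : classSize Y d (d y) ≡ 1
  class-y = countV-single _ y (∧-intro yy (does-refl (d y))) λ i e →
    alone i (∧-elimˡ (Y i) e) (d-injective i y (∧-elimˡ (Y i) e) yy (does-sound (d i) (d y) (∧-elimʳ (Y i) e)))

cstar-one-elim : ∀ {n} (X : Adj n) Y → IsCStar X Y 1 → Σ ℕ λ k → Σ (Fin n) λ u → Y u ≡ true
  × ChiN X Y (suc k) × Col X (λ i → Y i ∧ not (does (i ≟ u))) k
cstar-one-elim X Y (zero , _ , (c , _ , () , _) , _)
cstar-one-elim X Y (suc k , chi , (c , prc , a , size) , _) with countV-one _ size
... | u , u∈a , alone = k , u , ∧-elimˡ (Y u) u∈a , isChi→chiN u (∧-elimˡ (Y u) u∈a) chi ,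
      drop-unused-colour X _ k c (λ i j yi yj x → prc i j (∧-elimˡ (Y i) yi) (∧-elimˡ (Y j) yj) x) a avoid
  where
  avoid : ∀ i → (Y i ∧ not (does (i ≟ u))) ≡ true → c i ≢ a
  avoid i yi refl with alone i (∧-intro (∧-elimˡ (Y i) yi) (does-refl (c i)))
  ... | refl = not-both (∧-elimʳ (Y i) yi) (does-refl i)

Sel : ∀ {n} → Adj n → Fin n → Fin n → Bool
Sel F i j = F i j ∨ F j i

Sel-sym : ∀ {n} (F : Adj n) i j → Sel F i j ≡ Sel F j i
Sel-sym F i j = ∨-comm (F i j) (F j i)

kept : ∀ {n} (X F : Adj n) i j → X i j ≡ true → Sel F i j ≡ false → removeE X F i j ≡ true
kept X F i j x s rewrite x | s = refl

removed-sub : ∀ {n} (X F : Adj n) i j → removeE X F i j ≡ true → X i j ≡ true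
removed-sub X F i j e = ∧-elimˡ (X i j) e

removed-unselected : ∀ {n} (X F : Adj n) i j → removeE X F i j ≡ true → Sel F i j ≡ false
removed-unselected X F i j e with Sel F i j | ∧-elimʳ (X i j) e
... | false | _ = refl

col-remove : ∀ {n} {X : Adj n} (F : Adj n) {P k} → Col X P k → Col (removeE X F) P k
col-remove {X = X} F = col-restrict (λ _ pi → pi) λ i j _ _ r → removed-sub X F i j r

col-unremove : ∀ {n} {X F : Adj n} {P k} → (∀ i j → P i ≡ true → P j ≡ true → X i j ≡ true → Sel F i j ≡ false)
  → Col (removeE X F) P k → Col X P k
col-unremove {X = X} {F} none = col-restrict (λ _ pi → pi) λ i j pi pj x → kept X F i j x (none i j pi pj x)

Pair : ∀ {n} → Fin n → Fin n → Fin n → Fin n → Set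
Pair u v i j = (i ≡ u × j ≡ v) ⊎ (i ≡ v × j ≡ u)

Pair-sym : ∀ {n} {u v i j : Fin n} → Pair u v i j → Pair u v j i
Pair-sym (inj₁ (a , b)) = inj₂ (b , a)
Pair-sym (inj₂ (a , b)) = inj₁ (b , a)

Pair-swap : ∀ {n} {u v i j : Fin n} → Pair u v i j → Pair v u i j
Pair-swap (inj₁ x) = inj₂ x
Pair-swap (inj₂ x) = inj₁ x

theEdge : ∀ {n} → Fin n → Fin n → Adj n
theEdge u v i j = does (i ≟ u) ∧ does (j ≟ v)

theEdge-selects : ∀ {n} (u v i j : Fin n) → Sel (theEdge u v) i j ≡ true → Pair u v i j
theEdge-selects u v i j e with ∨-elim (theEdge u v i j) e
... | inj₁ q = inj₁ (does-sound i u (∧-elimˡ _ q) , does-sound j v (∧-elimʳ (does (i ≟ u)) q))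
... | inj₂ q = inj₂ (does-sound i v (∧-elimʳ (does (j ≟ u)) q) , does-sound j u (∧-elimˡ _ q))

theEdge-selected : ∀ {n} {u v i j : Fin n} → Pair u v i j → Sel (theEdge u v) i j ≡ true
theEdge-selected {u = u} {v} (inj₁ (refl , refl)) rewrite does-refl u | does-refl v = refl
theEdge-selected {u = u} {v} (inj₂ (refl , refl)) rewrite does-refl u | does-refl v = ∨-zeroʳ _

module EdgeCount {n : ℕ} (X : Adj n) (X-sym : ∀ i j → X i j ≡ X j i) (X-irrefl : ∀ i → X i i ≡ false) where

  distinct : ∀ i j → X i j ≡ true → i ≢ j
  distinct i j x refl = false≢true (trans (sym (X-irrefl i)) x)

  counted : VSet n → Adj n → Fin n → Fin n → Bool
  counted P F i j = (toℕ i <ᵇ toℕ j) ∧ P i ∧ P j ∧ X i j ∧ (F i j ∨ F j i)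

  counted-sound : ∀ P F i j → counted P F i j ≡ true
    → toℕ i < toℕ j × P i ≡ true × P j ≡ true × X i j ≡ true × Sel F i j ≡ true
  counted-sound P F i j e with toℕ i <ᵇ toℕ j in lt | P i | P j | X i j | Sel F i j
  ... | true | true | true | true | true = <ᵇ⇒< _ _ (≡→T lt) , refl , refl , refl , refl

  counted-complete : ∀ P F i j → toℕ i < toℕ j → P i ≡ true → P j ≡ true → X i j ≡ true → Sel F i j ≡ true
    → counted P F i j ≡ true
  counted-complete P F i j lt pi pj x s rewrite T→≡ (<⇒<ᵇ lt) | pi | pj | x = s

  counted-either : ∀ P F i j → P i ≡ true → P j ≡ true → X i j ≡ true → Sel F i j ≡ true
    → counted P F i j ≡ true ⊎ counted P F j i ≡ true
  counted-either P F i j pi pj x s with <-cmp (toℕ i) (toℕ j)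
  ... | tri< lt _ _ = inj₁ (counted-complete P F i j lt pi pj x s)
  ... | tri≈ _ e _  = ⊥-elim (distinct i j x (FinP.toℕ-injective e))
  ... | tri> _ _ gt = inj₂ (counted-complete P F j i gt pj pi (trans (X-sym j i) x) (trans (Sel-sym F j i) s))

  count-zero : ∀ P F → edgeCount X P F ≡ 0 → ∀ i j → P i ≡ true → P j ≡ true → X i j ≡ true → Sel F i j ≡ false
  count-zero P F e i j pi pj x = not-true _ λ s → [ uncounted i j , uncounted j i ]′ (counted-either P F i j pi pj x s)
    where
    uncounted : ∀ a b → counted P F a b ≡ true → ⊥
    uncounted a b q = false≢true (trans (sym (countV-zero⁻ (counted P F a) (sumV-zero⁻ _ e a) b)) q)

  -- removing no edge does not lower χ
  lowers-pos : ∀ P F → Lowers X P F → 1 ≤ edgeCount X P F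
  lowers-pos P F (k , (c , pr) , nc) with edgeCount X P F in e
  ... | suc _ = s≤s z≤n
  ... | zero  = ⊥-elim (nc (c , λ i j pi pj x → pr i j pi pj (kept X F i j x (count-zero P F e i j pi pj x))))

  SelectsAtMost : VSet n → Adj n → Fin n → Fin n → Set
  SelectsAtMost P F u v = ∀ i j → P i ≡ true → P j ≡ true → X i j ≡ true → Sel F i j ≡ true → Pair u v i j

  count-≤1 : ∀ P F u v → SelectsAtMost P F u v → edgeCount X P F ≤ 1
  count-≤1 P F u v only = sumV-≤1 _ (λ i → countV-≤1 _ λ j j′ a b → proj₂ (same i j i j′ a b))
    λ i i′ a b → let (j , q) = countV-witness _ a ; (j′ , q′) = countV-witness _ b in proj₁ (same i j i′ j′ q q′)
    where
    same : ∀ i j i′ j′ → counted P F i j ≡ true → counted P F i′ j′ ≡ true → i ≡ i′ × j ≡ j′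
    same i j i′ j′ a b with counted-sound P F i j a | counted-sound P F i′ j′ b
    ... | lt , pi , pj , x , s | lt′ , pi′ , pj′ , x′ , s′ with only i j pi pj x s | only i′ j′ pi′ pj′ x′ s′
    ... | inj₁ (refl , refl) | inj₁ (refl , refl) = refl , refl
    ... | inj₂ (refl , refl) | inj₂ (refl , refl) = refl , refl
    ... | inj₁ (refl , refl) | inj₂ (refl , refl) = ⊥-elim (<-asym lt lt′)
    ... | inj₂ (refl , refl) | inj₁ (refl , refl) = ⊥-elim (<-asym lt lt′)

  count-one : ∀ P F → edgeCount X P F ≡ 1 → Σ (Fin n) λ u → Σ (Fin n) λ v
    → P u ≡ true × P v ≡ true × X u v ≡ true × SelectsAtMost P F u v
  count-one P F e with sumV-one _ e
  ... | u , fu , u-only with countV-one (counted P F u) fu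
  ...   | v , cuv , v-only = u , v , pu , pv , xuv , only
    where
    pu = proj₁ (proj₂ (counted-sound P F u v cuv))
    pv = proj₁ (proj₂ (proj₂ (counted-sound P F u v cuv)))
    xuv = proj₁ (proj₂ (proj₂ (proj₂ (counted-sound P F u v cuv))))
    the-pair : ∀ i j → counted P F i j ≡ true → i ≡ u × j ≡ v
    the-pair i j q with u-only i (λ z → 1+n≰n (subst (1 ≤_) z (countV-pos _ j q)))
    ... | refl = refl , v-only j q
    only : SelectsAtMost P F u v
    only i j pi pj x s with counted-either P F i j pi pj x s
    ... | inj₁ q = inj₁ (the-pair i j q)
    ... | inj₂ q = Pair-sym (inj₁ (the-pair j i q))

  -- giving u a fresh colour restores the removed edges
  col-add-edge : ∀ {k} P F u v → SelectsAtMost P F u v → Col (removeE X F) P k → Col X P (suc k)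
  col-add-edge P F u v only = col-fresh u X-irrefl λ i j pi pj x i≢u j≢u →
    kept X F i j x (not-true _ λ s → contains-u (only i j pi pj x s) i≢u j≢u)
    where
    contains-u : ∀ {i j} → Pair u v i j → i ≢ u → j ≢ u → ⊥
    contains-u (inj₁ (e , _)) i≢u _ = i≢u e
    contains-u (inj₂ (_ , e)) _ j≢u = j≢u e

  -- on a set Q ⊆ P avoiding u nothing was removed
  col-unremove-avoiding : ∀ {k} P Q F u v → SelectsAtMost P F u v → (∀ i → Q i ≡ true → P i ≡ true)
    → Q u ≡ false → Col (removeE X F) Q k → Col X Q k
  col-unremove-avoiding P Q F u v only Q⊆P u∉Q =
    col-unremove {X = X} {F} λ i j qi qj x → not-true _ λ s → avoids (only i j (Q⊆P i qi) (Q⊆P j qj) x s) qi qj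
    where
    avoids : ∀ {i j} → Pair u v i j → Q i ≡ true → Q j ≡ true → ⊥
    avoids (inj₁ (refl , _)) qi _ = false≢true (trans (sym u∉Q) qi)
    avoids (inj₂ (_ , refl)) _ qj = false≢true (trans (sym u∉Q) qj)

  col-remove-the-edge : ∀ {k} P F u v → SelectsAtMost P F u v
    → Col (removeE X F) P k → Col (removeE X (theEdge u v)) P k
  col-remove-the-edge P F u v only = col-restrict (λ _ pi → pi) λ i j pi pj r →
    let x = removed-sub X (theEdge u v) i j r in
    kept X F i j x (not-true _ λ s →
      false≢true (trans (sym (removed-unselected X (theEdge u v) i j r)) (theEdge-selected (only i j pi pj x s))))

  es-pos : ∀ P e → IsEs X P e → HasEdge X P → 1 ≤ e
  es-pos P e (inj₁ (no-edge , _)) h = ⊥-elim (no-edge h)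
  es-pos P e (inj₂ (_ , (F , ec , lw) , _)) h = subst (1 ≤_) ec (lowers-pos P F lw)

  es-one-intro : ∀ P F u v → P u ≡ true → P v ≡ true → X u v ≡ true → SelectsAtMost P F u v
    → Lowers X P F → IsEs X P 1
  es-one-intro P F u v pu pv xuv only lw =
    inj₂ ((u , v , pu , pv , xuv) , (F , ≤-antisym (count-≤1 P F u v only) (lowers-pos P F lw) , lw) ,
          λ F′ lw′ → lowers-pos P F′ lw′)

  es-one-by-edge : ∀ P e → IsEs X P e → ∀ u v → P u ≡ true → P v ≡ true → X u v ≡ true
    → Lowers X P (theEdge u v) → e ≡ 1
  es-one-by-edge P e (inj₁ (no-edge , _)) u v pu pv xuv lw = ⊥-elim (no-edge (u , v , pu , pv , xuv))
  es-one-by-edge P e es@(inj₂ (h , _ , min)) u v pu pv xuv lw =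
    ≤-antisym (≤-trans (min (theEdge u v) lw) (count-≤1 P (theEdge u v) u v λ i j _ _ _ → theEdge-selects u v i j))
              (es-pos P e es h)

  record CriticalEdge (P : VSet n) : Set where
    field
      F       : Adj n
      u v     : Fin n
      u∈P     : P u ≡ true
      v∈P     : P v ≡ true
      uv-edge : X u v ≡ true
      only    : SelectsAtMost P F u v
      lowers  : Lowers X P F

  critical-edge : ∀ P → IsEs X P 1 → CriticalEdge P
  critical-edge P (inj₁ (_ , ()))
  critical-edge P (inj₂ (_ , (F , e , lw) , _)) with count-one P F e
  ... | u , v , pu , pv , xuv , only = record
    { F = F ; u = u ; v = v ; u∈P = pu ; v∈P = pv ; uv-edge = xuv ; only = only ; lowers = lw }

module ConditionI {n : ℕ} (G : SimpleGraph n) where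
  A : Adj n
  A = adj G

  A-sym : ∀ i j → A i j ≡ A j i
  A-sym = SimpleGraph.sym G

  A-irrefl : ∀ i → A i i ≡ false
  A-irrefl = SimpleGraph.irrefl G

  open Components A A-sym
  module EA = EdgeCount A A-sym A-irrefl

  Condition-i : Set
  Condition-i = ∃ λ C → IsComponent A C × SameChi A C allV × IsEs A C 1
    × (∀ D → IsComponent A D → SameChi A D allV → SameV D C)

  -- A critical edge uv of G: the component of u is the only component of chromatic
  -- number χ(G), since every other component is coloured by the colouring of G − uv.
  es-one→condition-i : IsEs A allV 1 → Condition-i
  es-one→condition-i es = C , comp-isComponent u , same-chi , es-C , unique
    where
    open EA.CriticalEdge (EA.critical-edge allV es)
    k = proj₁ lowers
    col-k : Col (removeE A F) allV k
    col-k = toCol (proj₁ (proj₂ lowers))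
    not-k : ¬ Col A allV k
    not-k c = proj₂ (proj₂ lowers) (fromCol u refl c)
    C = comp u
    u∈C : C u ≡ true
    u∈C = comp-self u
    chi-G : ChiN A allV (suc k)
    chi-G = chiN-suc (EA.col-add-edge allV F u v only col-k) not-k
    -- away from u, the colouring of G − F colours G
    col-away : ∀ Q → Q u ≡ false → Col A Q k
    col-away Q u∉Q = EA.col-unremove-avoiding allV Q F u v only (λ _ _ → refl) u∉Q
      (col-restrict (λ _ _ → refl) (λ _ _ _ _ r → r) col-k)
    chi-C : ChiN A C (suc k)
    chi-C = chiN-suc (col-restrict (λ _ _ → refl) (λ _ _ _ _ a → a) (proj₁ chi-G))
      λ col-C → not-k (col-glue-closed (comp-no-cross u) col-C (col-away _ (cong not u∈C)))
    same-chi : SameChi A C allV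
    same-chi = suc k , chiN→isChi u u∈C chi-C , chiN→isChi u refl chi-G
    es-C : IsEs A C 1
    es-C = EA.es-one-intro C F u v u∈C (comp-closed u u v u∈C uv-edge) uv-edge (λ i j _ _ → only i j refl refl)
      (k , fromCol u u∈C (col-restrict (λ _ _ → refl) (λ _ _ _ _ r → r) col-k) , λ c → proj₂ chi-C k ≤-refl (toCol c))
    unique : ∀ D → IsComponent A D → SameChi A D allV → SameV D C
    unique D cD (m , chi-D , chi-G′) with D u in u∈D
    ... | true  = comp-unique D cD u u∈D
    ... | false = ⊥-elim (proj₂ chi-D′ k ≤-refl (col-away D u∈D))
      where
      chi-D′ : ChiN A D (suc k)
      chi-D′ = subst (ChiN A D) (chiN-unique (isChi→chiN u refl chi-G′) chi-G)
                 (isChi→chiN (proj₁ (proj₁ cD)) (proj₂ (proj₁ cD)) chi-D)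

  -- Conversely, with a critical edge uv of the unique critical component C, every other
  -- component is χ(G) − 1 colourable, so G − uv is; hence es(G) = 1.
  condition-i→es-one : Condition-i → ∀ a → IsEs A allV a → a ≡ 1
  condition-i→es-one (C , cC , (m , chi-C′ , chi-G′) , es-C , unique) a es-G =
    ¬¬-≡ λ a≢1 → ¬¬-∀Fin _ colourable λ cols → a≢1 (lowered cols)
    where
    open EA.CriticalEdge (EA.critical-edge C es-C)
    k = proj₁ lowers
    col-k : Col (removeE A F) C k
    col-k = toCol (proj₁ (proj₂ lowers))
    chi-C : ChiN A C (suc k)
    chi-C = chiN-suc (EA.col-add-edge C F u v only col-k) λ c → proj₂ (proj₂ lowers) (fromCol u u∈P c)
    chi-G : ChiN A allV (suc k)
    chi-G = subst (ChiN A allV) (chiN-unique (isChi→chiN u u∈P chi-C′) chi-C) (isChi→chiN u refl chi-G′)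
    G-uv = removeE A (theEdge u v)
    colourable : ∀ w → ¬ ¬ Col G-uv (comp w) k
    colourable w with comp w u in e
    ... | true  = λ nk → nk (col-restrict inside-C (λ _ _ _ _ r → r) (EA.col-remove-the-edge C F u v only col-k))
      where
      inside-C : ∀ x → comp w x ≡ true → C x ≡ true
      inside-C x cx = trans (comp-unique C cC u u∈P x) (trans (sym (comp-of-member w u e x)) cx)
    ... | false = λ nk → not-critical λ c → nk (col-remove (theEdge u v) c)
      where
      -- otherwise comp w would be a second component of chromatic number χ(G)
      not-critical : ¬ ¬ Col A (comp w) k
      not-critical nc = false≢true (trans (sym e) (trans (unique (comp w) (comp-isComponent w) same-chi u) u∈P))
        where
        same-chi : SameChi A (comp w) allV
        same-chi = suc k ,
          chiN→isChi w (comp-self w) (chiN-suc (col-restrict (λ _ _ → refl) (λ _ _ _ _ a → a) (proj₁ chi-G)) nc) ,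
          chiN→isChi u refl chi-G
    lowered : (∀ w → Col G-uv (comp w) k) → a ≡ 1
    lowered cols = EA.es-one-by-edge allV a es-G u v refl refl uv-edge
      (k , fromCol u refl (col-glue-components (removed-sub A (theEdge u v)) cols) ,
       λ c → proj₂ chi-G k ≤-refl (toCol c))

-- Condition (ii): es(Ḡ) = 1 iff es(C̄) = 1 for a component C, or c*(C̄) = c*(D̄) = 1 for
-- two components C ≠ D.  Ḡ is the join of the complements of the components of G, so
-- χ(Ḡ) adds up over the components.

module ConditionII {n : ℕ} (G : SimpleGraph n) where
  open ConditionI G using (A; A-sym; A-irrefl)
  open Components A A-sym

  Ā : Adj n
  Ā = compl A

  Ā-sym : ∀ i j → Ā i j ≡ Ā j i
  Ā-sym i j rewrite A-sym i j | does-sym i j = refl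

  Ā-irrefl : ∀ i → Ā i i ≡ false
  Ā-irrefl i rewrite does-refl i = ∧-zeroʳ _

  module EB = EdgeCount Ā Ā-sym Ā-irrefl

  outside : VSet n → VSet n
  outside C i = not (C i)

  Condition-ii : Set
  Condition-ii = (∃ λ C → IsComponent A C × IsEs Ā C 1)
    ⊎ (∃ λ C → ∃ λ D → IsComponent A C × IsComponent A D × ¬ SameV C D × IsCStar Ā C 1 × IsCStar Ā D 1)

  compl-cross : ∀ P → IsComponent A P → ∀ p q → P p ≡ true → P q ≡ false → Ā p q ≡ true
  compl-cross P (_ , closed , _) p q pp pq =
    ∧-intro (cong not (not-true _ λ a → false≢true (trans (sym pq) (closed p q pp a))))
            (cong not (does-distinct p q λ { refl → false≢true (trans (sym pq) pp) }))

  compl-cross-outside : ∀ C → IsComponent A C → ∀ p q → C p ≡ true → outside C q ≡ true → Ā p q ≡ true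
  compl-cross-outside C cC p q cp oq = compl-cross C cC p q cp (not-true _ λ cq → not-both oq cq)

  component-join-bound : ∀ C → IsComponent A C → ∀ {s₁ s₂ t}
    → (∀ t₁ → Col Ā C t₁ → s₁ ≤ t₁) → (∀ t₂ → Col Ā (outside C) t₂ → s₂ ≤ t₂) → Col Ā allV t → s₁ + s₂ ≤ t
  component-join-bound C cC = join-bound Ā allV C (outside C) (λ _ _ → refl) (λ _ _ → refl) (compl-cross-outside C cC)

  -- A critical edge uv of C̄ is critical for Ḡ: colour C̄ − uv with χ(C̄) − 1 colours and
  -- the rest with χ(Ḡ − C) further colours.
  critical-inside→es-one : (∃ λ C → IsComponent A C × IsEs Ā C 1) → ∀ b → IsEs Ā allV b → b ≡ 1
  critical-inside→es-one (C , cC , es-C) b es-Ḡ =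
    ¬¬-≡ λ b≢1 → ¬¬-chromatic Ā (outside C) Ā-irrefl λ (r , col-r , min-r) → b≢1 (lowered r col-r min-r)
    where
    open EB.CriticalEdge (EB.critical-edge C es-C)
    k = proj₁ lowers
    col-k : Col (removeE Ā F) C k
    col-k = toCol (proj₁ (proj₂ lowers))
    not-k : ¬ Col Ā C k
    not-k c = proj₂ (proj₂ lowers) (fromCol u u∈P c)
    lowered : ∀ r → Col Ā (outside C) r → (∀ s → Col Ā (outside C) s → r ≤ s) → b ≡ 1
    lowered r col-r min-r = EB.es-one-by-edge allV b es-Ḡ u v refl refl uv-edge
      (k + r , fromCol u refl col-uv , λ c → 1+n≰n (component-join-bound C cC (needs-suc not-k) min-r (toCol c)))
      where
      col-uv : Col (removeE Ā (theEdge u v)) allV (k + r)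
      col-uv = col-join (EB.col-remove-the-edge C F u v only col-k) (col-remove (theEdge u v) col-r) (λ i _ ci → cong not ci)

  cover-pair : ∀ c d x y → (c ∨ d) ≡ true → (x ∨ y) ≡ false → ((c ∧ not x) ∨ (d ∧ not y)) ≡ true
  cover-pair true  d     false false _ _ = refl
  cover-pair false true  false false _ _ = refl

  cover-rest : ∀ c d → (c ∨ d) ≡ false → (not c ∧ not d) ≡ true
  cover-rest false false _ = refl

  colour-count : ∀ a b r → suc a + (suc b + r) ≡ suc (1 + (a + b) + r)
  colour-count a b r = cong suc (trans (+-suc a (b + r)) (cong suc (sym (+-assoc a b r))))

  -- If u and v are alone in their colour classes of χ-colourings of C̄ and D̄, then uv is
  -- critical for Ḡ: u and v may share a colour in Ḡ − uv.
  cstar-pair→es-one : (∃ λ C → ∃ λ D → IsComponent A C × IsComponent A D × ¬ SameV C D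
                          × IsCStar Ā C 1 × IsCStar Ā D 1) → ∀ b → IsEs Ā allV b → b ≡ 1
  cstar-pair→es-one (C , D , cC , cD , C≢D , cs-C , cs-D) b es-Ḡ
    with cstar-one-elim Ā C cs-C | cstar-one-elim Ā D cs-D
  ... | kC , u , u∈C , chi-C , col-C-u | kD , v , v∈D , chi-D , col-D-v =
    ¬¬-≡ λ b≢1 → ¬¬-chromatic Ā W Ā-irrefl λ (r , col-r , min-r) → b≢1 (lowered r col-r min-r)
    where
    W : VSet n
    W i = not (C i) ∧ not (D i)
    D∩C-empty : ∀ i → D i ≡ true → C i ≡ false
    D∩C-empty = components-disjoint D C cD cC λ D≡C → C≢D λ w → sym (D≡C w)
    Ḡ-uv = removeE Ā (theEdge u v)
    UV : VSet n
    UV i = does (i ≟ u) ∨ does (i ≟ v)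
    -- u and v are only adjacent to each other in Ḡ − uv within {u, v}
    col-UV : Col Ḡ-uv UV 1
    col-UV = (λ _ → 0) , (λ _ _ → s≤s z≤n) , λ i j ui uj r _ →
      false≢true (trans (sym (removed-unselected Ā (theEdge u v) i j r))
        (theEdge-selected (the-pair i j ui uj (EB.distinct i j (removed-sub Ā (theEdge u v) i j r)))))
      where
      the-pair : ∀ i j → UV i ≡ true → UV j ≡ true → i ≢ j → Pair u v i j
      the-pair i j ui uj i≢j with ∨-elim (does (i ≟ u)) ui | ∨-elim (does (j ≟ u)) uj
      ... | inj₁ a | inj₁ b = ⊥-elim (i≢j (trans (does-sound i u a) (sym (does-sound j u b))))
      ... | inj₁ a | inj₂ b = inj₁ (does-sound i u a , does-sound j v b)
      ... | inj₂ a | inj₁ b = inj₂ (does-sound i v a , does-sound j u b)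
      ... | inj₂ a | inj₂ b = ⊥-elim (i≢j (trans (does-sound i v a) (sym (does-sound j v b))))
    -- Ḡ − uv: {u, v} with one colour, C − u and D − v with kC + kD colours, W with r colours
    C∪D-uv : VSet n
    C∪D-uv i = (C i ∧ not (does (i ≟ u))) ∨ (D i ∧ not (does (i ≟ v)))
    col-C∪D : Col Ḡ-uv (λ i → C i ∨ D i) (1 + (kC + kD))
    col-C∪D = col-join col-UV
      (col-join {R = C∪D-uv} (col-remove (theEdge u v) col-C-u) (col-remove (theEdge u v) col-D-v) (λ i e ne → ∨-right e ne))
      (λ i e ne → cover-pair (C i) (D i) (does (i ≟ u)) (does (i ≟ v)) e ne)
    lowered : ∀ r → Col Ā W r → (∀ s → Col Ā W s → r ≤ s) → b ≡ 1
    lowered r col-r min-r = EB.es-one-by-edge allV b es-Ḡ u v refl refl (compl-cross C cC u v u∈C (D∩C-empty v v∈D))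
      (1 + (kC + kD) + r , fromCol u refl col-uv , λ c → 1+n≰n (needed (toCol c)))
      where
      col-uv : Col Ḡ-uv allV (1 + (kC + kD) + r)
      col-uv = col-join col-C∪D (col-remove (theEdge u v) col-r) (λ i _ e → cover-rest (C i) (D i) e)
      -- χ(Ḡ) ≥ χ(C̄) + χ(D̄) + χ(W̄)
      needed : ∀ {t} → Col Ā allV t → suc (1 + (kC + kD) + r) ≤ t
      needed {t} c = subst (_≤ t) (colour-count kC kD r)
        (component-join-bound C cC (chiN-needs chi-C) outside-C c)
        where
        outside-C : ∀ t₂ → Col Ā (outside C) t₂ → suc kD + r ≤ t₂
        outside-C _ = join-bound Ā (outside C) D W (λ i di → cong not (D∩C-empty i di)) (λ i wi → ∧-elimˡ (not (C i)) wi)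
          (λ p q dp wq → compl-cross D cD p q dp (not-true _ λ dq → not-both (∧-elimʳ (not (C q)) wq) dq))
          (chiN-needs chi-D) min-r

  condition-ii→es-one : Condition-ii → ∀ b → IsEs Ā allV b → b ≡ 1
  condition-ii→es-one = [ critical-inside→es-one , cstar-pair→es-one ]′

  -- Conversely, fix a critical edge uv of Ḡ: an edge set F selecting only uv and a colouring
  -- c of Ḡ − F with k colours, where Ḡ is not k-colourable.  Y is the component of u.
  module CriticalEdgeOfComplement (F : Adj n) (u v : Fin n) (only : EB.SelectsAtMost allV F u v)
    (k : ℕ) (c : Fin n → ℕ) (bd : ∀ i → true ≡ true → c i < k) (pr : ProperN (removeE Ā F) allV c)
    (not-k : ¬ Col Ā allV k) where

    Y : VSet n
    Y = comp u

    u∈Y : Y u ≡ true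
    u∈Y = comp-self u

    leaves-Y : ∀ p q → Y p ≡ true → outside Y q ≡ true → Ā p q ≡ true
    leaves-Y = compl-cross-outside Y (comp-isComponent u)

    -- outside Y nothing is removed
    col-outside : ∀ {t} → Col (removeE Ā F) (outside Y) t → Col Ā (outside Y) t
    col-outside = EB.col-unremove-avoiding allV (outside Y) F u v only (λ _ _ → refl) (cong not u∈Y)

    too-few : ∀ {s t₂} → Col Ā Y s → Col Ā (outside Y) t₂ → ¬ s + t₂ ≤ k
    too-few col-Y col-out le = not-k (col-weaken (col-join col-Y col-out (λ i _ e → cong not e)) le)

    -- Case uv inside Y: the edges leaving Y are kept, so Ȳ and the rest use disjoint
    -- palettes, and F lowers χ(Ȳ).
    critical-within : Ā u v ≡ true → Y v ≡ true → IsEs Ā Y 1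
    critical-within uv-edge v∈Y = lowered (Split.split-disjoint (removeE Ā F) allV Y (outside Y) c k bd pr
                                             (λ _ _ → refl) (λ _ _ → refl) different)
      where
      different : ∀ p q → Y p ≡ true → outside Y q ≡ true → c p ≢ c q
      different p q yp oq = pr p q refl refl
        (kept Ā F p q (leaves-Y p q yp oq) (not-true _ λ s → leaves (only p q refl refl (leaves-Y p q yp oq) s)))
        where
        leaves : Pair u v p q → ⊥
        leaves (inj₁ (_ , refl)) = not-both oq v∈Y
        leaves (inj₂ (_ , refl)) = not-both oq u∈Y
      lowered : (Σ ℕ λ t₁ → Σ ℕ λ t₂ → Col (removeE Ā F) Y t₁ × Col (removeE Ā F) (outside Y) t₂ × t₁ + t₂ ≤ k)
        → IsEs Ā Y 1
      lowered (t₁ , t₂ , col-Y , col-out , le) = EB.es-one-intro Y F u v u∈Y v∈Y uv-edge (λ i j _ _ → only i j refl refl)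
        (t₁ , fromCol u u∈Y col-Y , λ c′ → too-few (toCol c′) (col-outside col-out) le)

    -- Case v outside Y: u and v have the same colour, as uv is the only removed edge.
    same-colour : c u ≡ c v
    same-colour with c u ℕ.≟ c v
    ... | yes eq = eq
    ... | no ne  = ⊥-elim (not-k (c , bd , proper))
      where
      proper : ProperN Ā allV c
      proper i j _ _ a with Sel F i j in s
      ... | false = pr i j refl refl (kept Ā F i j a s)
      ... | true with only i j refl refl a s
      ...   | inj₁ (refl , refl) = ne
      ...   | inj₂ (refl , refl) = λ eq → ne (sym eq)

    -- Case v outside Y, continued: only the colour of u can be shared between Ȳ and the
    -- rest; compressing c on Y gives a χ-colouring of Ȳ in which u is alone.
    cstar-at-u : Y v ≡ false → IsCStar Ā Y 1
    cstar-at-u v∉Y = from-split (Split.split-one-shared (removeE Ā F) allV Y (outside Y) c k bd pr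
                                   (λ _ _ → refl) (λ _ _ → refl) (c u) shared-is-cu)
      where
      shared-is-cu : ∀ p q → Y p ≡ true → outside Y q ≡ true → c p ≡ c q → c p ≡ c u
      shared-is-cu p q yp oq eq with Sel F p q in s
      ... | false = ⊥-elim (pr p q refl refl (kept Ā F p q (leaves-Y p q yp oq) s) eq)
      ... | true with only p q refl refl (leaves-Y p q yp oq) s
      ...   | inj₁ (refl , _) = refl
      ...   | inj₂ (refl , _) = ⊥-elim (false≢true (trans (sym v∉Y) yp))
      from-split : (Σ ℕ λ t₁ → Σ ℕ λ t₂ → Col (removeE Ā F) (outside Y) t₂ × t₁ + t₂ ≤ suc k
          × (Σ (Fin n → ℕ) λ c′ → (∀ i → Y i ≡ true → c′ i < t₁) × ProperN (removeE Ā F) Y c′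
              × (∀ i j → Y i ≡ true → Y j ≡ true → c′ i ≡ c′ j → c i ≡ c j)))
        → IsCStar Ā Y 1
      from-split (t₁ , t₂ , col-out , le , c′ , bd′ , pr′ , same′) =
        cstar-one Ā Y t₁ u u∈Y chi-Y c′ bd′ (proj₂ (proj₂ col-Y)) alone
        where
        -- Y avoids v, so nothing inside Y is removed
        col-Y : Col Ā Y t₁
        col-Y = EB.col-unremove-avoiding allV Y F v u (λ i j pi pj x s → Pair-swap (only i j pi pj x s))
                  (λ _ _ → refl) v∉Y (c′ , bd′ , pr′)
        chi-Y : ChiN Ā Y t₁
        chi-Y = col-Y , λ s s<t₁ col-s →
          too-few col-s (col-outside col-out) (≤-pred (≤-trans (+-monoˡ-≤ t₂ s<t₁) le))
        alone : ∀ i → Y i ≡ true → c′ i ≡ c′ u → i ≡ u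
        alone i yi eq with i ≟ u
        ... | yes i≡u = i≡u
        ... | no i≢u  = ⊥-elim (pr i v refl refl (kept Ā F i v iv-edge (not-true _ λ s → not-uv (only i v refl refl iv-edge s)))
                                 (trans (same′ i u yi u∈Y eq) same-colour))
          where
          iv-edge : Ā i v ≡ true
          iv-edge = leaves-Y i v yi (cong not v∉Y)
          not-uv : Pair u v i v → ⊥
          not-uv (inj₁ (i≡u , _)) = i≢u i≡u
          not-uv (inj₂ (refl , _)) = false≢true (trans (sym v∉Y) yi)

  es-one→condition-ii : IsEs Ā allV 1 → Condition-ii
  es-one→condition-ii es = from-critical (EB.critical-edge allV es)
    where
    from-critical : EB.CriticalEdge allV → Condition-ii
    from-critical record { F = F ; u = u ; v = v ; uv-edge = uv-edge ; only = only ; lowers = k , col-k , not-k }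
      with toCol col-k | comp u v in uv-comp
    ... | c , bd , pr | true  = inj₁ (comp u , comp-isComponent u , Cu.critical-within uv-edge uv-comp)
      where module Cu = CriticalEdgeOfComplement F u v only k c bd pr (λ c′ → not-k (fromCol u refl c′))
    ... | c , bd , pr | false =
      inj₂ (comp u , comp v , comp-isComponent u , comp-isComponent v , distinct ,
            Cu.cstar-at-u uv-comp , Cv.cstar-at-u vu-comp)
      where
      module Cu = CriticalEdgeOfComplement F u v only k c bd pr (λ c′ → not-k (fromCol u refl c′))
      module Cv = CriticalEdgeOfComplement F v u (λ i j pi pj x s → Pair-swap (only i j pi pj x s))
                    k c bd pr (λ c′ → not-k (fromCol u refl c′))
      vu-comp : comp v u ≡ false
      vu-comp = not-true _ λ vu → false≢true (trans (sym uv-comp) (trans (sym (comp-of-member v u vu v)) (comp-self v)))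
      distinct : ¬ SameV (comp u) (comp v)
      distinct same = false≢true (trans (sym vu-comp) (trans (sym (same u)) (comp-self u)))

  -- in an edgeless G every component is a single vertex, so c*(C̄) = 1
  edgeless-cstar : ¬ HasEdge A allV → ∀ P → IsComponent A P → IsCStar Ā P 1
  edgeless-cstar edgeless P ((p , p∈P) , _ , connected) =
    cstar-one Ā P 1 p p∈P chi-P (λ _ → 0) (λ _ _ → s≤s z≤n) proper (λ i i∈P _ → only-p i i∈P)
    where
    no-step : ∀ {w} → Reach A p w → w ≡ p
    no-step here = refl
    no-step (step {i} {j} x r) = ⊥-elim (edgeless (i , j , refl , refl , x))
    only-p : ∀ w → P w ≡ true → w ≡ p
    only-p w w∈P = no-step (connected p w p∈P w∈P)
    proper : ProperN Ā P (λ _ → 0)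
    proper i j i∈P j∈P a _ rewrite only-p i i∈P | only-p j j∈P = false≢true (trans (sym (Ā-irrefl p)) a)
    chi-P : ChiN Ā P 1
    chi-P = chiN-suc ((λ _ → 0) , (λ _ _ → s≤s z≤n) , proper) (λ (c , bd , _) → n≮0 (bd p p∈P))

  compl-has-edge : (∃ λ P → ∃ λ Q → IsComponent A P × IsComponent A Q × ¬ SameV P Q) → HasEdge Ā allV
  compl-has-edge (P , Q , cP , cQ , P≢Q) with proj₁ cP | proj₁ cQ
  ... | p , p∈P | q , q∈Q = p , q , refl , refl ,
        compl-cross P cP p q p∈P (components-disjoint Q P cQ cP (λ Q≡P → P≢Q λ w → sym (Q≡P w)) q q∈Q)

both-one : ∀ a b → 1 ≤ a → 1 ≤ b → a + b ≡ 2 → a ≡ 1 × b ≡ 1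
both-one (suc zero) (suc zero) _ _ _ = refl , refl
both-one (suc zero) (suc (suc b)) _ _ ()
both-one (suc (suc a)) (suc b) _ _ e = ⊥-elim (1+n≢0 (trans (sym (+-suc a b)) (suc-injective (suc-injective e))))

proposition3p1 : ∀ {n} (G : SimpleGraph n)
    → (∃ λ P → ∃ λ Q → IsComponent (adj G) P × IsComponent (adj G) Q × ¬ SameV P Q)
    → ∀ a b → IsEs (adj G) allV a → IsEs (compl (adj G)) allV b
    → (a + b ≡ 2
       ⇔ ((∃ λ C → IsComponent (adj G) C × SameChi (adj G) C allV × IsEs (adj G) C 1
              × (∀ D → IsComponent (adj G) D → SameChi (adj G) D allV → SameV D C))
          × ((∃ λ C → IsComponent (adj G) C × IsEs (compl (adj G)) C 1)
             ⊎ (∃ λ C → ∃ λ D → IsComponent (adj G) C × IsComponent (adj G) D × ¬ SameV C D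
                  × IsCStar (compl (adj G)) C 1 × IsCStar (compl (adj G)) D 1))))
proposition3p1 G two-components a b es-G es-Ḡ = mk⇔ (forward es-G) backward
  where
  open ConditionI G
  open ConditionII G
  forward : IsEs A allV a → a + b ≡ 2 → Condition-i × Condition-ii
  -- G edgeless: a = 0, while b = 1 as the components are single vertices
  forward (inj₁ (edgeless , a≡0)) sum =
    let (P , Q , cP , cQ , P≢Q) = two-components
        b≡1 = cstar-pair→es-one (P , Q , cP , cQ , P≢Q , edgeless-cstar edgeless P cP , edgeless-cstar edgeless Q cQ) b es-Ḡ
    in ⊥-elim (1+n≢n (sym (trans (sym (cong₂ _+_ a≡0 b≡1)) sum)))
  forward es@(inj₂ (has-edge , _)) sum
    with both-one a b (EA.es-pos allV a es has-edge) (EB.es-pos allV b es-Ḡ (compl-has-edge two-components)) sum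
  ... | a≡1 , b≡1 = es-one→condition-i (subst (IsEs A allV) a≡1 es) , es-one→condition-ii (subst (IsEs Ā allV) b≡1 es-Ḡ)
  backward : Condition-i × Condition-ii → a + b ≡ 2
  backward (cond-i , cond-ii) = cong₂ _+_ (condition-i→es-one cond-i a es-G) (condition-ii→es-one cond-ii b es-Ḡ)
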